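{- Let $L$ be a Latin square and consider lazy burning on the hypergraph $H^L$. Let $R^*$, $C^*$ and $S^*$ be, respectively, a set of rows, a set of columns and a set of symbols of $L$ that are burned initially (and no other vertices), and suppose at least two of $|R^*|,|C^*|,|S^*|$ are nonzero. Then, after the burning finishes propagating, the set of burned lines is exactly the set of rows, columns and symbols of the smallest subsquare of $L$ that intersects every line in $R^*\cup C^*\cup S^*$.
   Context: A Latin square $L$ of order $n$ is identified with its set of entries $(r,c,s)$ (symbol $s$ in row $r$, column $c$). A line of $L$ is a row, a column, or a symbol of $L$ (equivalently the set of entries in it). The hypergraph $H^L$ has vertex set the $3n$ lines of $L$ (rows, columns and symbols treated as distinct vertices) and, for each entry $(r,c,s)$ of $L$, a hyperedge $\{r,c,s\}$. Lazy burning: a chosen set of vertices is burned in the first round; in each subsequent round, every unburned vertex $v$ lying in a hyperedge all of whose other vertices were burned by the end of the previous round becomes burned. A subsquare of $L$ is a subset of the entries that is itself a Latin square; it intersects a line if it contains an entry of that line. -}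

module Defs where

open import Data.Nat using (ℕ; zero; suc; _<_)
open import Data.Fin using (Fin)
open import Data.Fin.Subset using (Subset; _∈_; ∣_∣)
open import Data.Product using (Σ; ∃; ∃-syntax; _×_; _,_)
open import Data.Sum using (_⊎_)
open import Relation.Binary.PropositionalEquality using (_≡_)
open import Function.Bundles using (_⇔_)

∃!Fin : ∀ {n} → (Fin n → Set) → Set
∃!Fin {n} P = Σ (Fin n) λ x → P x × (∀ y → P y → y ≡ x)

record LatinSquare (n : ℕ) : Set where
  field
    cell   : Fin n → Fin n → Fin n
    rowLat : ∀ r s → ∃!Fin (λ c → cell r c ≡ s)
    colLat : ∀ c s → ∃!Fin (λ r → cell r c ≡ s)
open LatinSquare public

-- Lines of L: the 3n vertices of H^L (rows, columns, symbols kept distinct).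
data Line (n : ℕ) : Set where
  row : Fin n → Line n
  col : Fin n → Line n
  sym : Fin n → Line n

-- A set of entries of L.  Since an entry (r,c,s) of L is determined by its
-- cell (r,c) (s = cell L r c), a set of entries is a predicate on cells.
EntrySet : ℕ → Set₁
EntrySet n = Fin n → Fin n → Set

module _ {n : ℕ} (L : LatinSquare n) where

  Meets : EntrySet n → Line n → Set
  Meets T (row r) = ∃[ c ] T r c
  Meets T (col c) = ∃[ r ] T r c
  Meets T (sym s) = ∃[ r ] ∃[ c ] (T r c × cell L r c ≡ s)

  -- T is itself a Latin square (on its own rows R, columns C, symbols S):
  -- every cell of R × C holds an entry of T, and each symbol of S occurs
  -- in every row of R and every column of C (at most once is automatic,
  -- since T consists of entries of the Latin square L).
  IsSubsquare : EntrySet n → Set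
  IsSubsquare T =
      (∀ r c → Meets T (row r) → Meets T (col c) → T r c)
    × (∀ r s → Meets T (row r) → Meets T (sym s) → ∃[ c ] (T r c × cell L r c ≡ s))
    × (∀ c s → Meets T (col c) → Meets T (sym s) → ∃[ r ] (T r c × cell L r c ≡ s))

  _⊆E_ : EntrySet n → EntrySet n → Set
  T ⊆E T' = ∀ r c → T r c → T' r c

  Initial : Subset n → Subset n → Subset n → Line n → Set
  Initial R C S (row r) = r ∈ R
  Initial R C S (col c) = c ∈ C
  Initial R C S (sym s) = s ∈ S

  -- Lazy burning on H^L: BurnedBy R C S k v means v is burned by the end
  -- of round k+1 (round 1 = the initial set).  A vertex becomes burned when
  -- some hyperedge {r, c, cell L r c} containing it has its other two
  -- vertices already burned.
  BurnedBy : Subset n → Subset n → Subset n → ℕ → Line n → Set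
  BurnedBy R C S zero v = Initial R C S v
  BurnedBy R C S (suc k) (row r) =
    BurnedBy R C S k (row r)
    ⊎ ∃[ c ] (BurnedBy R C S k (col c) × BurnedBy R C S k (sym (cell L r c)))
  BurnedBy R C S (suc k) (col c) =
    BurnedBy R C S k (col c)
    ⊎ ∃[ r ] (BurnedBy R C S k (row r) × BurnedBy R C S k (sym (cell L r c)))
  BurnedBy R C S (suc k) (sym s) =
    BurnedBy R C S k (sym s)
    ⊎ ∃[ r ] ∃[ c ] (cell L r c ≡ s × BurnedBy R C S k (row r) × BurnedBy R C S k (col c))

  Burned : Subset n → Subset n → Subset n → Line n → Set
  Burned R C S v = ∃[ k ] BurnedBy R C S k v

  AtLeastTwoNonzero : Subset n → Subset n → Subset n → Set
  AtLeastTwoNonzero R C S =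
    (0 < ∣ R ∣ × 0 < ∣ C ∣) ⊎ (0 < ∣ R ∣ × 0 < ∣ S ∣) ⊎ (0 < ∣ C ∣ × 0 < ∣ S ∣)

-- Lazy burning only ever burns the third line of an entry whose other two lines
-- are burned, so the burned lines form the least set of lines containing the
-- initial ones and closed under that rule.  The lines met by a subsquare are
-- closed under the same rule (the Latin property of L pins down the missing
-- entry), hence contain every burned line.  Conversely, as soon as a row and a
-- column are burned (here the hypothesis on |R*|, |C*|, |S*| is used), the
-- entries whose row and column are both burned form a subsquare whose lines
-- are exactly the burned ones; it is therefore the smallest one.
module Submission where

open import Defs
open import Data.Nat using (ℕ; zero; suc; _+_; _<_)
open import Data.Nat.Properties using (+-comm)
open import Data.Fin using (Fin)
open import Data.Fin.Subset using (Subset; Nonempty; inside; outside; ∣_∣)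
open import Data.Vec using (_∷_; here; there)
open import Data.Product using (Σ; _×_; _,_; ∃-syntax; proj₁; proj₂)
open import Data.Sum using (inj₁; inj₂)
open import Function.Bundles using (_⇔_; mk⇔; Equivalence)
open import Relation.Binary.PropositionalEquality using (_≡_; refl; trans; subst) renaming (sym to ≡-sym)

∣p∣>0⇒Nonempty : ∀ {m} (p : Subset m) → 0 < ∣ p ∣ → Nonempty p
∣p∣>0⇒Nonempty (inside ∷ p) _ = Fin.zero , here
∣p∣>0⇒Nonempty (outside ∷ p) h with ∣p∣>0⇒Nonempty p h
... | x , x∈p = Fin.suc x , there x∈p

module _ {n : ℕ} (L : LatinSquare n) where

  cell-injectiveˡ : ∀ {r r′ c} → cell L r′ c ≡ cell L r c → r′ ≡ r
  cell-injectiveˡ {r} {r′} {c} e with colLat L c (cell L r c)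
  ... | _ , _ , unique = trans (unique r′ e) (≡-sym (unique r refl))

  cell-injectiveʳ : ∀ {r c c′} → cell L r c′ ≡ cell L r c → c′ ≡ c
  cell-injectiveʳ {r} {c} {c′} e with rowLat L r (cell L r c)
  ... | _ , _ , unique = trans (unique c′ e) (≡-sym (unique c refl))

  record HyperedgeClosed (P : Line n → Set) : Set where
    field
      row-closed : ∀ r c → P (col c) → P (sym (cell L r c)) → P (row r)
      col-closed : ∀ r c → P (row r) → P (sym (cell L r c)) → P (col c)
      sym-closed : ∀ r c → P (row r) → P (col c) → P (sym (cell L r c))

  module HyperedgeClosedProperties {P : Line n → Set} (closed : HyperedgeClosed P) where
    open HyperedgeClosed closed

    col-in-row : ∀ r s → P (row r) → P (sym s) → ∃[ c ] (cell L r c ≡ s × P (col c))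
    col-in-row r s pr ps with rowLat L r s
    ... | c , e , _ = c , e , col-closed r c pr (subst (λ x → P (sym x)) (≡-sym e) ps)

    row-in-col : ∀ c s → P (col c) → P (sym s) → ∃[ r ] (cell L r c ≡ s × P (row r))
    row-in-col c s pc ps with colLat L c s
    ... | r , e , _ = r , e , row-closed r c pc (subst (λ x → P (sym x)) (≡-sym e) ps)

    entriesOf : EntrySet n
    entriesOf r c = P (row r) × P (col c)

    entriesOf-⊆E : ∀ {T′} → IsSubsquare L T′ → (∀ v → P v → Meets L T′ v) → _⊆E_ L entriesOf T′
    entriesOf-⊆E (full , _) P⊆T′ r c (pr , pc) = full r c (P⊆T′ (row r) pr) (P⊆T′ (col c) pc)

    module _ (someRow : ∃[ r ] P (row r)) (someCol : ∃[ c ] P (col c)) where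

      ⇔-Meets-entriesOf : ∀ v → P v ⇔ Meets L entriesOf v
      ⇔-Meets-entriesOf v = mk⇔ (P⇒meets v) (meets⇒P v)
        where
        meets⇒P : ∀ v → Meets L entriesOf v → P v
        meets⇒P (row r) (_ , pr , _) = pr
        meets⇒P (col c) (_ , _ , pc) = pc
        meets⇒P (sym s) (r , c , (pr , pc) , e) = subst (λ x → P (sym x)) e (sym-closed r c pr pc)

        P⇒meets : ∀ v → P v → Meets L entriesOf v
        P⇒meets (row r) pr = proj₁ someCol , pr , proj₂ someCol
        P⇒meets (col c) pc = proj₁ someRow , proj₂ someRow , pc
        P⇒meets (sym s) ps =
          let (r , pr) = someRow ; (c , e , pc) = col-in-row r s pr ps
          in r , c , (pr , pc) , e

      entriesOf-isSubsquare : IsSubsquare L entriesOf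
      entriesOf-isSubsquare =
          (λ r c mr mc → inP (row r) mr , inP (col c) mc)
        , (λ r s mr ms → let (c , e , pc) = col-in-row r s (inP (row r) mr) (inP (sym s) ms)
                         in c , (inP (row r) mr , pc) , e)
        , (λ c s mc ms → let (r , e , pr) = row-in-col c s (inP (col c) mc) (inP (sym s) ms)
                         in r , (pr , inP (col c) mc) , e)
        where
        inP : ∀ v → Meets L entriesOf v → P v
        inP v = Equivalence.from (⇔-Meets-entriesOf v)

  Meets-closed : ∀ {T} → IsSubsquare L T → HyperedgeClosed (Meets L T)
  Meets-closed {T} (full , rowSym , colSym) = record
    { row-closed = λ r c mc ms →
        let (r′ , t , e) = colSym c (cell L r c) mc ms
        in c , subst (λ x → T x c) (cell-injectiveˡ e) t
    ; col-closed = λ r c mr ms →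
        let (c′ , t , e) = rowSym r (cell L r c) mr ms
        in r , subst (T r) (cell-injectiveʳ e) t
    ; sym-closed = λ r c mr mc → r , c , full r c mr mc , refl
    }

  module _ (R C S : Subset n) where

    BurnedBy-suc : ∀ k v → BurnedBy L R C S k v → BurnedBy L R C S (suc k) v
    BurnedBy-suc k (row _) = inj₁
    BurnedBy-suc k (col _) = inj₁
    BurnedBy-suc k (sym _) = inj₁

    BurnedBy-+ : ∀ m k v → BurnedBy L R C S k v → BurnedBy L R C S (m + k) v
    BurnedBy-+ zero k v b = b
    BurnedBy-+ (suc m) k v b = BurnedBy-suc (m + k) v (BurnedBy-+ m k v b)

    Burned-sameRound : ∀ v w → Burned L R C S v → Burned L R C S w →
                       ∃[ k ] (BurnedBy L R C S k v × BurnedBy L R C S k w)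
    Burned-sameRound v w (k , bv) (l , bw) =
      l + k , BurnedBy-+ l k v bv , subst (λ i → BurnedBy L R C S i w) (+-comm k l) (BurnedBy-+ k l w bw)

    Burned-closed : HyperedgeClosed (Burned L R C S)
    Burned-closed = record
      { row-closed = λ r c bc bs →
          let (k , x , y) = Burned-sameRound (col c) (sym (cell L r c)) bc bs in suc k , inj₂ (c , x , y)
      ; col-closed = λ r c br bs →
          let (k , x , y) = Burned-sameRound (row r) (sym (cell L r c)) br bs in suc k , inj₂ (r , x , y)
      ; sym-closed = λ r c br bc →
          let (k , x , y) = Burned-sameRound (row r) (col c) br bc in suc k , inj₂ (r , c , refl , x , y)
      }

    Burned-least : ∀ {P} → HyperedgeClosed P → (∀ v → Initial L R C S v → P v) →
                   ∀ v → Burned L R C S v → P v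
    Burned-least {P} closed initial v (k , b) = burnedBy⇒P k v b
      where
      open HyperedgeClosed closed
      burnedBy⇒P : ∀ k v → BurnedBy L R C S k v → P v
      burnedBy⇒P zero v b = initial v b
      burnedBy⇒P (suc k) (row r) (inj₁ b) = burnedBy⇒P k (row r) b
      burnedBy⇒P (suc k) (row r) (inj₂ (c , bc , bs)) = row-closed r c (burnedBy⇒P k (col c) bc) (burnedBy⇒P k _ bs)
      burnedBy⇒P (suc k) (col c) (inj₁ b) = burnedBy⇒P k (col c) b
      burnedBy⇒P (suc k) (col c) (inj₂ (r , br , bs)) = col-closed r c (burnedBy⇒P k (row r) br) (burnedBy⇒P k _ bs)
      burnedBy⇒P (suc k) (sym s) (inj₁ b) = burnedBy⇒P k (sym s) b
      burnedBy⇒P (suc k) (sym s) (inj₂ (r , c , refl , br , bc)) = sym-closed r c (burnedBy⇒P k (row r) br) (burnedBy⇒P k (col c) bc)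

    open HyperedgeClosedProperties Burned-closed

    Burned-someRowCol : AtLeastTwoNonzero L R C S →
                        (∃[ r ] Burned L R C S (row r)) × (∃[ c ] Burned L R C S (col c))
    Burned-someRowCol (inj₁ (R≠∅ , C≠∅)) =
      let (r , r∈R) = ∣p∣>0⇒Nonempty R R≠∅ ; (c , c∈C) = ∣p∣>0⇒Nonempty C C≠∅
      in (r , 0 , r∈R) , (c , 0 , c∈C)
    Burned-someRowCol (inj₂ (inj₁ (R≠∅ , S≠∅))) =
      let (r , r∈R) = ∣p∣>0⇒Nonempty R R≠∅ ; (s , s∈S) = ∣p∣>0⇒Nonempty S S≠∅
          (c , _ , bc) = col-in-row r s (0 , r∈R) (0 , s∈S)
      in (r , 0 , r∈R) , (c , bc)
    Burned-someRowCol (inj₂ (inj₂ (C≠∅ , S≠∅))) =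
      let (c , c∈C) = ∣p∣>0⇒Nonempty C C≠∅ ; (s , s∈S) = ∣p∣>0⇒Nonempty S S≠∅
          (r , _ , br) = row-in-col c s (0 , c∈C) (0 , s∈S)
      in (r , br) , (c , 0 , c∈C)

lemma3p1 : (n : ℕ) (L : LatinSquare n) (R C S : Subset n) →
    AtLeastTwoNonzero L R C S →
    Σ (EntrySet n) λ T →
    IsSubsquare L T
    × (∀ v → Initial L R C S v → Meets L T v)
    × (∀ T′ → IsSubsquare L T′ → (∀ v → Initial L R C S v → Meets L T′ v) → _⊆E_ L T T′)
    × (∀ v → Burned L R C S v ⇔ Meets L T v)
lemma3p1 n L R C S nonzero =
    entriesOf
  , entriesOf-isSubsquare someRow someCol
  , (λ v i → Equivalence.to (⇔-Meets-entriesOf someRow someCol v) (0 , i))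
  , (λ T′ sq initial → entriesOf-⊆E sq (Burned-least L R C S (Meets-closed L sq) initial))
  , ⇔-Meets-entriesOf someRow someCol
  where
  open HyperedgeClosedProperties L (Burned-closed L R C S)
  someRow : ∃[ r ] Burned L R C S (row r)
  someRow = proj₁ (Burned-someRowCol L R C S nonzero)
  someCol : ∃[ c ] Burned L R C S (col c)
  someCol = proj₂ (Burned-someRowCol L R C S nonzero)
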